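{- Let $S$ be a set of binary words all of the same length and the same weight. If $\mathcal{L}$ is a list containing each word of $S$ exactly once which is a homogeneous Gray code and which is suffix partitioned, then $\mathcal{L}$ is a recursive tail partitioned list.
   Context: The weight of a binary word is its number of 1's. Two binary words differ by a homogeneous transposition if one is obtained from the other by transposing a 1 with a 0 such that there are no 1's between the two transposed positions. A list of words is a homogeneous Gray code if any two consecutive words in it differ by a homogeneous transposition. A list of words is suffix partitioned if, for every word $s$, the words of the list having suffix $s$ appear consecutively in the list. The tail of a binary word is its unique suffix of the form $01^m$ ($m\ge 0$); the words $1^n$ have no tail (note that $0$ is the tail of any word ending with 0). A list of binary words is increasing (resp. decreasing) tail partitioned if, for every $\ell\ge1$, all words whose tail has length $\ell$ appear before (resp. after) all words whose tail has length $\ell+1$. A list $\mathcal L$ of same-length binary words is recursive tail partitioned if it is empty, or (i) it is increasing or decreasing tail partitioned, and (ii) for every tail $t$, the list obtained by taking the sublist of $\mathcal L$ of words with tail $t$ (in the same order) and erasing the suffix $t$ from each of its words is again recursive tail partitioned. -}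

module Defs where

open import Data.Bool using (Bool; true; false; not)
open import Data.Bool.Properties using () renaming (_≟_ to _≟ᵇ_)
open import Data.Nat using (ℕ; zero; suc)
open import Data.List using (List; []; _∷_; _++_; replicate; reverse; length; lookup; mapMaybe)
open import Data.Maybe using (Maybe; just; nothing)
import Data.Maybe as Maybe
open import Data.Fin using (Fin) renaming (_<_ to _<ᶠ_; _≤_ to _≤ᶠ_)
open import Data.Product using (Σ; ∃; _×_; _,_)
open import Data.Sum using (_⊎_)
open import Data.Unit using (⊤)
open import Relation.Binary.PropositionalEquality using (_≡_)
open import Relation.Nullary using (does)

Word : Set
Word = List Bool

weight : Word → ℕ
weight [] = 0
weight (true ∷ w) = suc (weight w)
weight (false ∷ w) = weight w

HomTrans : Word → Word → Set
HomTrans u v =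
  Σ Word λ p → Σ Word λ q → Σ ℕ λ m → Σ Bool λ a →
    (u ≡ p ++ (a ∷ replicate m false ++ not a ∷ q)) ×
    (v ≡ p ++ (not a ∷ replicate m false ++ a ∷ q))

HomGray : List Word → Set
HomGray [] = ⊤
HomGray (u ∷ []) = ⊤
HomGray (u ∷ v ∷ L) = HomTrans u v × HomGray (v ∷ L)

_IsSuffixOf_ : Word → Word → Set
s IsSuffixOf w = ∃ λ p → w ≡ p ++ s

SuffixPartitioned : List Word → Set
SuffixPartitioned L =
  (s : Word) (i j k : Fin (length L)) → i ≤ᶠ j → j ≤ᶠ k →
  s IsSuffixOf lookup L i → s IsSuffixOf lookup L k → s IsSuffixOf lookup L j

tailWord : ℕ → Word
tailWord m = false ∷ replicate m true

-- w has tail 0 1^m, i.e. tail of length m + 1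
HasTail : Word → ℕ → Set
HasTail w m = (tailWord m) IsSuffixOf w

IncTailPartitioned : List Word → Set
IncTailPartitioned L =
  (m : ℕ) (i j : Fin (length L)) →
  HasTail (lookup L i) m → HasTail (lookup L j) (suc m) → i <ᶠ j

DecTailPartitioned : List Word → Set
DecTailPartitioned L =
  (m : ℕ) (i j : Fin (length L)) →
  HasTail (lookup L i) m → HasTail (lookup L j) (suc m) → j <ᶠ i

stripPrefix : Word → Word → Maybe Word
stripPrefix [] w = just w
stripPrefix (x ∷ t) [] = nothing
stripPrefix (x ∷ t) (y ∷ w) with does (x ≟ᵇ y)
... | true = stripPrefix t w
... | false = nothing

stripSuffix : Word → Word → Maybe Word
stripSuffix t w = Maybe.map reverse (stripPrefix (reverse t) (reverse w))

restrictTail : ℕ → List Word → List Word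
restrictTail m L = mapMaybe (stripSuffix (tailWord m)) L

-- recursive tail partitioned lists (well-founded since erasing a tail shortens words)
data RecTailPartitioned : List Word → Set where
  rtp-empty : RecTailPartitioned []
  rtp-step  : {L : List Word} →
              (IncTailPartitioned L ⊎ DecTailPartitioned L) →
              ((m : ℕ) → RecTailPartitioned (restrictTail m L)) →
              RecTailPartitioned L

-- The words with a given suffix form a contiguous block of a suffix partitioned list, so
-- in particular the words with a given tail length do.  A homogeneous transposition
-- changes the tail length by at most one.  A sequence of naturals moving in steps of at
-- most one, in which every value occupies a contiguous block, is monotone: after a strict
-- rise from v it may never return to v, so it can no longer fall.  Hence the list is tail
-- partitioned.  Erasing a common tail t keeps both hypotheses: a transposition of two
-- words ending in t happens before t, and words with suffix s correspond to words with
-- suffix s ++ t.  Induction on the word length concludes.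
module Submission where

open import Defs
open import Data.Nat using (ℕ)
open import Data.List using (List; length)
open import Data.List.Relation.Unary.All using (All)
open import Data.List.Relation.Unary.Unique.Propositional using (Unique)
open import Relation.Binary.PropositionalEquality using (_≡_)

open import Level using (Level; _⊔_)
open import Data.Bool using (Bool; true; false; not)
open import Data.Empty using (⊥-elim)
open import Data.Unit using (tt)
open import Data.Nat using (zero; suc; _≤_; _<_; _≥_; z≤n; s≤s; s≤s⁻¹)
import Data.Nat.Properties as ℕ
import Data.Fin as Fin
open import Data.List using ([]; _∷_; _++_; replicate; reverse; lookup; map; mapMaybe; head; _∷ʳ_)
open import Data.List.Properties using (++-assoc; ++-cancelʳ; ∷-injectiveʳ; ∷ʳ-injectiveʳ;
  reverse-++; reverse-involutive; length-replicate; length-++-sucʳ; length-++-≤ˡ)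
open import Data.List.Relation.Unary.All as All using ([]; _∷_)
import Data.List.Relation.Unary.All.Properties as All
open import Data.List.Relation.Unary.Any.Properties using (lookup-index)
open import Data.List.Relation.Unary.Any using (index)
open import Data.List.Relation.Unary.Linked as Linked using (Linked; []; [-]; _∷_; _∷′_)
import Data.List.Relation.Unary.Linked.Properties as Linked
open import Data.Maybe using (Maybe; just; nothing; Is-just)
open import Data.Maybe.Relation.Unary.All as MaybeAll using (just; nothing)
import Data.Maybe.Relation.Unary.All.Properties as MaybeAll
import Data.Maybe.Relation.Unary.Any as MaybeAny
open import Data.Maybe.Relation.Binary.Connected using (Connected; just; just-nothing; nothing-just; nothing)
open import Data.Product using (∃₂; _×_; _,_)
open import Data.Sum using (_⊎_; inj₁; inj₂)
open import Function using (_∘_; flip)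
open import Function.Bundles using (_⇔_; mk⇔; Equivalence)
open import Relation.Binary.Core using (Rel)
open import Relation.Binary.Definitions using (Reflexive; Transitive)
open import Relation.Binary.PropositionalEquality using (refl; sym; trans; cong; subst; _≢_; module ≡-Reasoning)
open import Relation.Nullary using (¬_; Dec; yes; no)
import Relation.Nullary.Decidable as Dec
open import Relation.Unary using (Pred; Decidable; ∁; _⊆_)

private
  variable
    a b p q ℓ : Level
    A B : Set a

module _ {A : Set a} (P : Pred A p) where

  data InitialSegment : Pred (List A) (a ⊔ p) where
    stop : ∀ {xs} → All (∁ P) xs → InitialSegment xs
    keep : ∀ {x xs} → P x → InitialSegment xs → InitialSegment (x ∷ xs)

  data Contiguous : Pred (List A) (a ⊔ p) where
    []  : Contiguous []
    _∷_ : ∀ {x xs} → (P x → InitialSegment xs) → Contiguous xs → Contiguous (x ∷ xs)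

module _ {P : Pred A p} where

  contiguous-tail : ∀ {x xs} → Contiguous P (x ∷ xs) → Contiguous P xs
  contiguous-tail (_ ∷ c) = c

  never-returns : ∀ {x y xs} → Contiguous P (x ∷ y ∷ xs) → P x → ¬ P y → All (∁ P) xs
  never-returns (c ∷ _) px ¬py with c px
  ... | stop (_ ∷ ¬ps) = ¬ps
  ... | keep py _      = ⊥-elim (¬py py)

  lookup⇒contiguous : Decidable P → ∀ {xs} →
    (∀ i j k → i Fin.≤ j → j Fin.≤ k → P (lookup xs i) → P (lookup xs k) → P (lookup xs j)) →
    Contiguous P xs
  lookup⇒contiguous P? {[]}     _      = []
  lookup⇒contiguous P? {x ∷ xs} convex =
    (λ px → initial (λ j k j≤k → convex Fin.zero (Fin.suc j) (Fin.suc k) z≤n (s≤s j≤k) px)) ∷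
    lookup⇒contiguous P? (λ i j k i≤j j≤k →
      convex (Fin.suc i) (Fin.suc j) (Fin.suc k) (s≤s i≤j) (s≤s j≤k))
    where
    initial : ∀ {ys} → (∀ j k → j Fin.≤ k → P (lookup ys k) → P (lookup ys j)) →
              InitialSegment P ys
    initial {[]}     _    = stop []
    initial {y ∷ ys} down with P? y
    ... | yes py = keep py (initial (λ j k j≤k → down (Fin.suc j) (Fin.suc k) (s≤s j≤k)))
    ... | no ¬py = stop (¬py ∷ All.tabulate λ z∈ys pz →
                           ¬py (down Fin.zero (Fin.suc (index z∈ys)) z≤n (subst P (lookup-index z∈ys) pz)))

  linked-avoiding⇒contiguous : ∀ {R : Rel A ℓ} → (∀ {x y} → R x y → ¬ P x) →
                               ∀ {xs} → Linked R xs → Contiguous P xs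
  linked-avoiding⇒contiguous avoid []       = []
  linked-avoiding⇒contiguous avoid [-]      = (λ _ → stop []) ∷ []
  linked-avoiding⇒contiguous avoid (r ∷ rs) = (⊥-elim ∘ avoid r) ∷ linked-avoiding⇒contiguous avoid rs

module _ {P : Pred A p} {Q : Pred A q} (P⊆Q : P ⊆ Q) (Q⊆P : Q ⊆ P) where

  initialSegment-resp : ∀ {xs} → InitialSegment P xs → InitialSegment Q xs
  initialSegment-resp (stop ¬ps)  = stop (All.map (_∘ Q⊆P) ¬ps)
  initialSegment-resp (keep px i) = keep (P⊆Q px) (initialSegment-resp i)

  contiguous-resp : ∀ {xs} → Contiguous P xs → Contiguous Q xs
  contiguous-resp []       = []
  contiguous-resp (c ∷ cs) = (initialSegment-resp ∘ c ∘ Q⊆P) ∷ contiguous-resp cs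

module _ {P : Pred B p} (f : A → B) where

  initialSegment-map⁺ : ∀ {xs} → InitialSegment (P ∘ f) xs → InitialSegment P (map f xs)
  initialSegment-map⁺ (stop ¬ps)  = stop (All.map⁺ ¬ps)
  initialSegment-map⁺ (keep px i) = keep px (initialSegment-map⁺ i)

  contiguous-map⁺ : ∀ {xs} → Contiguous (P ∘ f) xs → Contiguous P (map f xs)
  contiguous-map⁺ []       = []
  contiguous-map⁺ (c ∷ cs) = (initialSegment-map⁺ ∘ c) ∷ contiguous-map⁺ cs

module _ (f : A → Maybe B) where

  mapMaybe-≡[] : ∀ {xs} → All (∁ (Is-just ∘ f)) xs → mapMaybe f xs ≡ []
  mapMaybe-≡[] []                 = refl
  mapMaybe-≡[] (_∷_ {x} ¬j ¬js) with f x
  ... | just _  = ⊥-elim (¬j (MaybeAny.just tt))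
  ... | nothing = mapMaybe-≡[] ¬js

  module _ {P : Pred A p} {Q : Pred B q} (P⇔Q : ∀ x → MaybeAll.All (λ y → P x ⇔ Q y) (f x)) where

    initialSegment-mapMaybe : ∀ {xs} → InitialSegment P xs → InitialSegment Q (mapMaybe f xs)
    initialSegment-mapMaybe (stop ¬ps) =
      stop (All.mapMaybe⁺ (All.map⁺ (All.map (λ {x} ¬px →
        MaybeAll.map (λ x⇔y → ¬px ∘ Equivalence.from x⇔y) (P⇔Q x)) ¬ps)))
    initialSegment-mapMaybe (keep {x} px i) with f x | P⇔Q x
    ... | just _  | just x⇔y = keep (Equivalence.to x⇔y px) (initialSegment-mapMaybe i)
    ... | nothing | nothing  = initialSegment-mapMaybe i

    contiguous-mapMaybe : ∀ {xs} → Contiguous P xs → Contiguous Q (mapMaybe f xs)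
    contiguous-mapMaybe []                = []
    contiguous-mapMaybe (_∷_ {x} c cs) with f x | P⇔Q x
    ... | just _  | just x⇔y =
      (initialSegment-mapMaybe ∘ c ∘ Equivalence.from x⇔y) ∷ contiguous-mapMaybe cs
    ... | nothing | nothing  = contiguous-mapMaybe cs

  module _ {R : Rel A ℓ} {S : Rel B q} (R⇒S : ∀ {x y} → R x y → Connected S (f x) (f y)) where

    -- Because the kept elements form a block, consecutive kept elements are consecutive in xs.
    linked-mapMaybe : ∀ {xs} → Contiguous (Is-just ∘ f) xs → Linked R xs → Linked S (mapMaybe f xs)
    linked-mapMaybe _ [] = []
    linked-mapMaybe _ ([-] {x}) with f x
    ... | just _  = [-]
    ... | nothing = []
    linked-mapMaybe (cx ∷ cs) (_∷_ {x} {y} {ys} r rs) with f x | R⇒S r | cx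
    ... | nothing | _   | _   = linked-mapMaybe cs rs
    ... | just u  | fxy | cx′ = next fxy (cx′ (MaybeAny.just tt)) ∷′ linked-mapMaybe cs rs
      where
      next : Connected S (just u) (f y) → InitialSegment (Is-just ∘ f) (y ∷ ys) →
             Connected S (just u) (head (mapMaybe f (y ∷ ys)))
      next fxy (keep jy _) with f y | fxy | jy
      ... | just _  | just s | _ = just s
      ... | nothing | _      | ()
      next _ (stop (¬jy ∷ ¬js)) with f y | ¬jy
      ... | just _  | ¬jy = ⊥-elim (¬jy (MaybeAny.just tt))
      ... | nothing | _ rewrite mapMaybe-≡[] ¬js = just-nothing

module _ {R : Rel A ℓ} (R-refl : Reflexive R) (R-trans : Transitive R) where

  linked-lookup-mono : ∀ {xs} → Linked R xs → ∀ {i j} → i Fin.≤ j → R (lookup xs i) (lookup xs j)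
  linked-lookup-mono {_ ∷ _}     _        {Fin.zero}  {Fin.zero}  _         = R-refl
  linked-lookup-mono {_ ∷ _ ∷ _} (r ∷ rs) {Fin.zero}  {Fin.suc j} _         =
    R-trans r (linked-lookup-mono rs {Fin.zero} {j} z≤n)
  linked-lookup-mono {_ ∷ _}     rs       {Fin.suc i} {Fin.suc j} (s≤s i≤j) =
    linked-lookup-mono (Linked.tail rs) i≤j

  linked-lookup-reflects : ∀ {xs} → Linked R xs → ∀ i j → ¬ R (lookup xs j) (lookup xs i) → i Fin.< j
  linked-lookup-reflects rs i j ¬R =
    Dec.decidable-stable (i Fin.<? j) (λ i≮j → ¬R (linked-lookup-mono rs (ℕ.≮⇒≥ i≮j)))

constant⇒linked : ∀ {R : Rel A ℓ} → Reflexive R → ∀ {y ys} → All (_≡ y) ys → Linked R (y ∷ ys)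
constant⇒linked R-refl []           = [-]
constant⇒linked R-refl (refl ∷ eqs) = R-refl ∷ constant⇒linked R-refl eqs

constant-run : ∀ {R : Rel A ℓ} {Q : Pred A q} {y ys} → (∀ {z} → R y z → Q z → z ≡ y) →
               Linked R (y ∷ ys) → All Q ys → All (_≡ y) ys
constant-run stay [-]      []        = []
constant-run stay (r ∷ rs) (qz ∷ qs) with refl ← stay r qz = refl ∷ constant-run stay rs qs

data WithinOne : ℕ → ℕ → Set where
  same : ∀ {n} → WithinOne n n
  up   : ∀ {n} → WithinOne n (suc n)
  down : ∀ {n} → WithinOne (suc n) n

≥-step-stays : ∀ {n z} → WithinOne (suc n) z × suc n ≥ z → z ≢ n → z ≡ suc n
≥-step-stays (same , _)       _   = refl
≥-step-stays (up   , 2+n≤1+n) _   = ⊥-elim (ℕ.1+n≰n 2+n≤1+n)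
≥-step-stays (down , _)       z≢n = ⊥-elim (z≢n refl)

≤-step-stays : ∀ {n z} → WithinOne n z × n ≤ z → z ≢ suc n → z ≡ n
≤-step-stays (same , _)     _     = refl
≤-step-stays (up   , _)     z≢1+n = ⊥-elim (z≢1+n refl)
≤-step-stays (down , 1+z≤z) _     = ⊥-elim (ℕ.1+n≰n 1+z≤z)

monotone⊎antitone : ∀ {xs} → Linked WithinOne xs → (∀ v → Contiguous (_≡ v) xs) →
                    Linked _≤_ xs ⊎ Linked _≥_ xs
monotone⊎antitone [] _  = inj₁ []
monotone⊎antitone [-] _ = inj₁ [-]
monotone⊎antitone (same ∷ steps) cont with monotone⊎antitone steps (contiguous-tail ∘ cont)
... | inj₁ mono = inj₁ (ℕ.≤-refl ∷ mono)
... | inj₂ anti = inj₂ (ℕ.≤-refl ∷ anti)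
monotone⊎antitone {x ∷ _} (up ∷ steps) cont with monotone⊎antitone steps (contiguous-tail ∘ cont)
... | inj₁ mono = inj₁ (ℕ.n≤1+n x ∷ mono)
... | inj₂ anti = inj₁ (ℕ.n≤1+n x ∷ constant⇒linked ℕ.≤-refl
        (constant-run ≥-step-stays (Linked.zip (steps , anti)) (never-returns (cont x) refl ℕ.1+n≢n)))
monotone⊎antitone {_ ∷ y ∷ _} (down ∷ steps) cont with monotone⊎antitone steps (contiguous-tail ∘ cont)
... | inj₂ anti = inj₂ (ℕ.n≤1+n y ∷ anti)
... | inj₁ mono = inj₂ (ℕ.n≤1+n y ∷ constant⇒linked ℕ.≤-refl
        (constant-run ≤-step-stays (Linked.zip (steps , mono))
          (never-returns (cont (suc y)) refl (ℕ.1+n≢n ∘ sym))))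

stripPrefix-spec : ∀ u w → MaybeAll.All (λ r → w ≡ u ++ r) (stripPrefix u w)
stripPrefix-spec []          w           = just refl
stripPrefix-spec (_ ∷ _)     []          = nothing
stripPrefix-spec (false ∷ u) (false ∷ w) = MaybeAll.map (cong (false ∷_)) (stripPrefix-spec u w)
stripPrefix-spec (false ∷ u) (true ∷ w)  = nothing
stripPrefix-spec (true ∷ u)  (false ∷ w) = nothing
stripPrefix-spec (true ∷ u)  (true ∷ w)  = MaybeAll.map (cong (true ∷_)) (stripPrefix-spec u w)

stripPrefix-++ : ∀ u r → stripPrefix u (u ++ r) ≡ just r
stripPrefix-++ []          r = refl
stripPrefix-++ (false ∷ u) r = stripPrefix-++ u r
stripPrefix-++ (true ∷ u)  r = stripPrefix-++ u r

stripSuffix-spec : ∀ t w → MaybeAll.All (λ p → w ≡ p ++ t) (stripSuffix t w)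
stripSuffix-spec t w =
  MaybeAll.map⁺ (MaybeAll.map reversed (stripPrefix-spec (reverse t) (reverse w)))
  where
  open ≡-Reasoning
  reversed : ∀ {r} → reverse w ≡ reverse t ++ r → w ≡ reverse r ++ t
  reversed {r} eq = begin
    w                                ≡⟨ sym (reverse-involutive w) ⟩
    reverse (reverse w)              ≡⟨ cong reverse eq ⟩
    reverse (reverse t ++ r)         ≡⟨ reverse-++ (reverse t) r ⟩
    reverse r ++ reverse (reverse t) ≡⟨ cong (reverse r ++_) (reverse-involutive t) ⟩
    reverse r ++ t                   ∎

stripSuffix-++ : ∀ t p → stripSuffix t (p ++ t) ≡ just p
stripSuffix-++ t p rewrite reverse-++ p t | stripPrefix-++ (reverse t) (reverse p) =
  cong just (reverse-involutive p)

stripSuffix⇔isSuffixOf : ∀ t w → Is-just (stripSuffix t w) ⇔ t IsSuffixOf w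
stripSuffix⇔isSuffixOf t w = mk⇔ to from
  where
  to : Is-just (stripSuffix t w) → t IsSuffixOf w
  to j with stripSuffix t w | stripSuffix-spec t w | j
  ... | just p | just w≡p++t | _ = p , w≡p++t
  from : t IsSuffixOf w → Is-just (stripSuffix t w)
  from (p , refl) rewrite stripSuffix-++ t p = MaybeAny.just tt

_isSuffixOf?_ : ∀ t w → Dec (t IsSuffixOf w)
t isSuffixOf? w =
  Dec.map (stripSuffix⇔isSuffixOf t w) (MaybeAny.dec (λ _ → yes tt) (stripSuffix t w))

++-isSuffixOf-++⇔ : ∀ s t p → (s ++ t) IsSuffixOf (p ++ t) ⇔ s IsSuffixOf p
++-isSuffixOf-++⇔ s t p = mk⇔ to from
  where
  to : (s ++ t) IsSuffixOf (p ++ t) → s IsSuffixOf p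
  to (r , eq) = r , ++-cancelʳ t p (r ++ s) (trans eq (sym (++-assoc r s t)))
  from : s IsSuffixOf p → (s ++ t) IsSuffixOf (p ++ t)
  from (r , refl) = r , ++-assoc r s t

∷-isSuffixOf-split : ∀ w (c : Bool) Q p t → w ++ c ∷ Q ≡ p ++ t →
                     t IsSuffixOf Q ⊎ (c ∷ Q) IsSuffixOf t
∷-isSuffixOf-split []      c Q []      t eq = inj₂ ([] , sym eq)
∷-isSuffixOf-split []      c Q (_ ∷ p) t eq = inj₁ (p , ∷-injectiveʳ eq)
∷-isSuffixOf-split (x ∷ w) c Q []      t eq = inj₂ (x ∷ w , sym eq)
∷-isSuffixOf-split (_ ∷ w) c Q (_ ∷ p) t eq = ∷-isSuffixOf-split w c Q p t (∷-injectiveʳ eq)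

∷-isSuffixOf-unique : ∀ {c c′ : Bool} {Q t} → (c ∷ Q) IsSuffixOf t → (c′ ∷ Q) IsSuffixOf t → c ≡ c′
∷-isSuffixOf-unique {c} {c′} {Q} (A , refl) (B , eq) =
  ∷ʳ-injectiveʳ A B (++-cancelʳ Q _ _ (begin
    (A ∷ʳ c) ++ Q   ≡⟨ ++-assoc A (c ∷ []) Q ⟩
    A ++ c ∷ Q      ≡⟨ eq ⟩
    B ++ c′ ∷ Q     ≡⟨ sym (++-assoc B (c′ ∷ []) Q) ⟩
    (B ∷ʳ c′) ++ Q  ∎))
  where open ≡-Reasoning

not≢ : ∀ x → not x ≢ x
not≢ true  ()
not≢ false ()

-- The two words differ in the letter just before Q, so their common suffix t lies inside Q.
transposition-before-suffix : ∀ {p q} t P Q k a →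
  p ++ t ≡ P ++ (a ∷ replicate k false ++ not a ∷ Q) →
  q ++ t ≡ P ++ (not a ∷ replicate k false ++ a ∷ Q) → t IsSuffixOf Q
transposition-before-suffix {p} {q} t P Q k a eu ev
  with ∷-isSuffixOf-split (P ++ a ∷ Z) (not a) Q p t
         (trans (++-assoc P (a ∷ Z) (not a ∷ Q)) (sym eu))
     | ∷-isSuffixOf-split (P ++ not a ∷ Z) a Q q t
         (trans (++-assoc P (not a ∷ Z) (a ∷ Q)) (sym ev))
  where Z = replicate k false
... | inj₁ t⊑Q | _        = t⊑Q
... | inj₂ _   | inj₁ t⊑Q = t⊑Q
... | inj₂ ¬aQ | inj₂ aQ  = ⊥-elim (not≢ a (∷-isSuffixOf-unique ¬aQ aQ))

homTrans-cancelʳ : ∀ {p q} t → HomTrans (p ++ t) (q ++ t) → HomTrans p q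
homTrans-cancelʳ {p} {q} t (P , Q , k , a , eu , ev) with transposition-before-suffix t P Q k a eu ev
... | Q′ , refl = P , Q′ , k , a , ++-cancelʳ t p _ (trans eu (reassoc a (not a))) ,
                                   ++-cancelʳ t q _ (trans ev (reassoc (not a) a))
  where
  reassoc : ∀ c d → P ++ (c ∷ replicate k false ++ d ∷ Q′ ++ t) ≡
                    (P ++ (c ∷ replicate k false ++ d ∷ Q′)) ++ t
  reassoc c d = trans (cong (λ r → P ++ c ∷ r) (sym (++-assoc (replicate k false) (d ∷ Q′) t)))
                      (sym (++-assoc P _ t))

stripSuffix-homTrans : ∀ t {x y} → HomTrans x y →
                       Connected HomTrans (stripSuffix t x) (stripSuffix t y)
stripSuffix-homTrans t {x} {y} h
  with stripSuffix t x | stripSuffix-spec t x | stripSuffix t y | stripSuffix-spec t y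
... | just _  | just refl | just _  | just refl = just (homTrans-cancelʳ t h)
... | just _  | _         | nothing | _         = just-nothing
... | nothing | _         | just _  | _         = nothing-just
... | nothing | _         | nothing | _         = nothing

stripSuffix-shortens : ∀ (c : Bool) t w →
                       MaybeAll.All (λ p → length p < length w) (stripSuffix (c ∷ t) w)
stripSuffix-shortens c t w = MaybeAll.map (λ { {p} refl →
  subst (length p <_) (sym (length-++-sucʳ p c t)) (s≤s (length-++-≤ˡ p)) })
  (stripSuffix-spec (c ∷ t) w)

module _ (t : Word) {L : List Word} where

  stripSuffix-linked : Contiguous (t IsSuffixOf_) L → Linked HomTrans L →
                       Linked HomTrans (mapMaybe (stripSuffix t) L)
  stripSuffix-linked = linked-mapMaybe (stripSuffix t) (stripSuffix-homTrans t) ∘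
    contiguous-resp (Equivalence.from (stripSuffix⇔isSuffixOf t _))
                    (Equivalence.to (stripSuffix⇔isSuffixOf t _))

  stripSuffix-contiguous : ∀ s → Contiguous ((s ++ t) IsSuffixOf_) L →
                           Contiguous (s IsSuffixOf_) (mapMaybe (stripSuffix t) L)
  stripSuffix-contiguous s = contiguous-mapMaybe (stripSuffix t)
    (λ w → MaybeAll.map (λ { {p} refl → ++-isSuffixOf-++⇔ s t p }) (stripSuffix-spec t w))

-- 0 stands for "no tail" (the words 1ⁿ); a tail 0 1ᵐ has length m + 1.
extendTail : Bool → Word → ℕ → ℕ
extendTail _     _ (suc ℓ) = suc ℓ
extendTail true  _ zero    = zero
extendTail false w zero    = suc (length w)

tailLength : Word → ℕ
tailLength []      = zero
tailLength (x ∷ w) = extendTail x w (tailLength w)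

tailLength-++ : ∀ p {w ℓ} → tailLength w ≡ suc ℓ → tailLength (p ++ w) ≡ suc ℓ
tailLength-++ []      eq = eq
tailLength-++ (x ∷ p) {w} eq = cong (extendTail x (p ++ w)) (tailLength-++ p eq)

tailLength-ones : ∀ r → tailLength (replicate r true) ≡ zero
tailLength-ones zero = refl
tailLength-ones (suc r) rewrite tailLength-ones r = refl

tailLength-tailWord : ∀ m → tailLength (tailWord m) ≡ suc m
tailLength-tailWord m rewrite tailLength-ones m = cong suc (length-replicate m)

tailLength-zeros-ones : ∀ k r → tailLength (replicate (suc k) false ++ replicate r true) ≡ suc r
tailLength-zeros-ones zero    r = tailLength-tailWord r
tailLength-zeros-ones (suc k) r rewrite tailLength-zeros-ones k r = refl

tailLength≡0⇒ones : ∀ w → tailLength w ≡ zero → w ≡ replicate (length w) true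
tailLength≡0⇒ones []      _  = refl
tailLength≡0⇒ones (x ∷ w) eq with tailLength w in e
tailLength≡0⇒ones (true ∷ w)  _  | zero = cong (true ∷_) (tailLength≡0⇒ones w e)
tailLength≡0⇒ones (false ∷ w) () | zero
tailLength≡0⇒ones (x ∷ w)     () | suc _

hasTail⇒tailLength : ∀ {w m} → HasTail w m → tailLength w ≡ suc m
hasTail⇒tailLength {m = m} (p , refl) = tailLength-++ p (tailLength-tailWord m)

tailLength⇒hasTail : ∀ w {m} → tailLength w ≡ suc m → HasTail w m
tailLength⇒hasTail (x ∷ w) eq with tailLength w in e
tailLength⇒hasTail (x ∷ w)     refl | suc _ with p , refl ← tailLength⇒hasTail w e = x ∷ p , refl
tailLength⇒hasTail (true ∷ w)  ()   | zero
tailLength⇒hasTail (false ∷ w) refl | zero = [] , cong (false ∷_) (tailLength≡0⇒ones w e)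

hasTail-< : ∀ {u v m} → HasTail u m → HasTail v (suc m) → tailLength u < tailLength v
hasTail-< {m = m} tu tv rewrite hasTail⇒tailLength tu | hasTail⇒tailLength tv = ℕ.n<1+n (suc m)

homTrans-tailLengths : ∀ {u v} → HomTrans u v →
  ∃₂ λ ℓ ℓ′ → tailLength u ≡ suc ℓ × tailLength v ≡ suc ℓ′ × WithinOne ℓ ℓ′
homTrans-tailLengths (p , q , k , a , refl , refl) with tailLength q in e
... | suc ℓ = ℓ , ℓ , tailLength-++ p (tailLength-++ (a ∷ replicate k false) (tailLength-++ (not a ∷ []) e))
                    , tailLength-++ p (tailLength-++ (not a ∷ replicate k false) (tailLength-++ (a ∷ []) e))
                    , same
... | zero rewrite tailLength≡0⇒ones q e with a
...   | true  = _ , _ , tailLength-++ p (tailLength-++ (true ∷ replicate k false) (tailLength-tailWord _))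
                      , tailLength-++ p (tailLength-zeros-ones k (suc _)) , up
...   | false = _ , _ , tailLength-++ p (tailLength-zeros-ones k (suc _))
                      , tailLength-++ p (tailLength-++ (true ∷ replicate k false) (tailLength-tailWord _)) , down

homTrans⇒withinOne : ∀ {u v} → HomTrans u v → WithinOne (tailLength u) (tailLength v)
homTrans⇒withinOne h with homTrans-tailLengths h
... | _ , _ , eu , ev , step rewrite eu | ev = suc-step step
  where
  suc-step : ∀ {m n} → WithinOne m n → WithinOne (suc m) (suc n)
  suc-step same = same
  suc-step up   = up
  suc-step down = down

homTrans⇒tailLength≢0 : ∀ {u v} → HomTrans u v → tailLength u ≢ zero
homTrans⇒tailLength≢0 h with homTrans-tailLengths h
... | _ , _ , eu , _ = λ eq → ℕ.1+n≢0 (trans (sym eu) eq)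

tailLength-contiguous : ∀ {L} → Linked HomTrans L → (∀ m → Contiguous (λ w → HasTail w m) L) →
                        ∀ ℓ → Contiguous (λ w → tailLength w ≡ ℓ) L
tailLength-contiguous gray _ zero    = linked-avoiding⇒contiguous homTrans⇒tailLength≢0 gray
tailLength-contiguous _ cont (suc m) =
  contiguous-resp hasTail⇒tailLength (tailLength⇒hasTail _) (cont m)

tailPartitioned : ∀ {L} → Linked HomTrans L → (∀ m → Contiguous (λ w → HasTail w m) L) →
                  IncTailPartitioned L ⊎ DecTailPartitioned L
tailPartitioned gray cont
  with monotone⊎antitone (Linked.map⁺ (Linked.map homTrans⇒withinOne gray))
                         (contiguous-map⁺ tailLength ∘ tailLength-contiguous gray cont)
... | inj₁ mono = inj₁ λ m i j ti tj →
  linked-lookup-reflects ℕ.≤-refl ℕ.≤-trans (Linked.map⁻ mono) i j (ℕ.<⇒≱ (hasTail-< ti tj))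
... | inj₂ anti = inj₂ λ m i j ti tj →
  linked-lookup-reflects ℕ.≤-refl (flip ℕ.≤-trans) (Linked.map⁻ anti) j i (ℕ.<⇒≱ (hasTail-< ti tj))

restrictTail-shorter : ∀ {b} m {L} → All (λ w → length w < suc b) L →
                       All (λ w → length w < b) (restrictTail m L)
restrictTail-shorter m = All.mapMaybe⁺ ∘ All.map⁺ ∘ All.map λ {w} w<1+b →
  MaybeAll.map (λ p<w → ℕ.<-≤-trans p<w (s≤s⁻¹ w<1+b)) (stripSuffix-shortens false (replicate m true) w)

recTailPartitioned : ∀ b L → All (λ w → length w < b) L → Linked HomTrans L →
                     (∀ s → Contiguous (s IsSuffixOf_) L) → RecTailPartitioned L
recTailPartitioned zero    []      _           _    _    = rtp-empty
recTailPartitioned zero    (_ ∷ _) (() ∷ _)    _    _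
recTailPartitioned (suc b) L       short       gray cont =
  rtp-step (tailPartitioned gray (cont ∘ tailWord)) λ m →
    recTailPartitioned b (restrictTail m L) (restrictTail-shorter m short)
      (stripSuffix-linked (tailWord m) (cont (tailWord m)) gray)
      (λ s → stripSuffix-contiguous (tailWord m) s (cont (s ++ tailWord m)))

homGray⇒linked : ∀ {L} → HomGray L → Linked HomTrans L
homGray⇒linked {[]}        _       = []
homGray⇒linked {_ ∷ []}    _       = [-]
homGray⇒linked {_ ∷ _ ∷ _} (h , g) = h ∷ homGray⇒linked g

theorem3 : (n k : ℕ) (L : List Word) →
    All (λ w → length w ≡ n) L → All (λ w → weight w ≡ k) L → Unique L →
    HomGray L → SuffixPartitioned L → RecTailPartitioned L
theorem3 n _ L lengths _ _ gray suffixPartitioned =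
  recTailPartitioned (suc n) L (All.map (λ { refl → ℕ.n<1+n _ }) lengths) (homGray⇒linked gray)
    (λ s → lookup⇒contiguous (s isSuffixOf?_) (suffixPartitioned s))
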